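{- Let $P,Q$ be posets and $\mathcal{I}$ a down-set in $\mathrm{Pro}(P,Q)$. Then the closure $\overline{\mathcal{I}}$ and the interior $\mathcal{I}^\circ$ are also down-sets. Likewise, the closure and interior of an up-set of $\mathrm{Pro}(P,Q)$ are up-sets.
   Context: $\widehat{Q}$ is the set of down-sets of $Q$ ordered by inclusion. A profunctor $f:P\to Q$ is an order-preserving map $f:P\to\widehat{Q}$; $\mathrm{Pro}(P,Q)$ is ordered pointwise by inclusion. $f$ is large if $\{p: f(p)\neq Q\}$ is finite, small if $\bigcup_p f(p)$ is finite. The topology on $\mathrm{Pro}(P,Q)$ has as basis the sets $U(g,h)=\{f: g\le f\le h\}$ with $g$ small and $h$ large. -}

module Defs where

open import Level using (Level; _⊔_; suc)
open import Relation.Binary.Bundles using (Poset)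
open import Relation.Unary using (Pred; _∈_; _⊆_)
open import Relation.Nullary using (¬_)
open import Data.Product using (Σ; ∃; _×_; _,_)
open import Data.List using (List)
open import Data.List.Relation.Unary.Any using (Any)

module ProDefs {c₁ ℓ₁ ℓ₂ c₂ ℓ₃ ℓ₄ : Level}
               (P : Poset c₁ ℓ₁ ℓ₂) (Q : Poset c₂ ℓ₃ ℓ₄) (ℓ : Level) where

  private
    module P = Poset P
    module Q = Poset Q

  record DownSetQ : Set (c₂ ⊔ ℓ₄ ⊔ suc ℓ) where
    field
      mem    : Pred Q.Carrier ℓ
      closed : ∀ {q q'} → q' Q.≤ q → q ∈ mem → q' ∈ mem
  open DownSetQ public

  record Pro : Set (c₁ ⊔ ℓ₂ ⊔ c₂ ⊔ ℓ₄ ⊔ suc ℓ) where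
    field
      app  : P.Carrier → DownSetQ
      mono : ∀ {p p'} → p P.≤ p' → mem (app p) ⊆ mem (app p')
  open Pro public

  _≤ᵖ_ : Pro → Pro → Set (c₁ ⊔ c₂ ⊔ ℓ)
  f ≤ᵖ g = ∀ p → mem (app f p) ⊆ mem (app g p)

  -- large: {p | f(p) ≠ Q} is finite (contained in a finite list, up to ≈)
  Large : Pro → Set (c₁ ⊔ ℓ₁ ⊔ c₂ ⊔ ℓ)
  Large f = Σ (List P.Carrier) λ L →
              ∀ p → ¬ (∀ q → q ∈ mem (app f p)) → Any (p P.≈_) L

  -- small: ⋃_p f(p) is finite (contained in a finite list, up to ≈)
  Small : Pro → Set (c₁ ⊔ c₂ ⊔ ℓ₃ ⊔ ℓ)
  Small f = Σ (List Q.Carrier) λ L →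
              ∀ p q → q ∈ mem (app f p) → Any (q Q.≈_) L

  U : Pro → Pro → Pred Pro (c₁ ⊔ c₂ ⊔ ℓ)
  U g h f = g ≤ᵖ f × f ≤ᵖ h

  -- open sets of the topology generated by the basis {U(g,h) | g small, h large}
  IsOpen : ∀ {s} → Pred Pro s → Set (c₁ ⊔ ℓ₁ ⊔ ℓ₂ ⊔ c₂ ⊔ ℓ₃ ⊔ ℓ₄ ⊔ suc ℓ ⊔ s)
  IsOpen O = ∀ f → f ∈ O → Σ Pro λ g → Σ Pro λ h →
               Small g × Large h × f ∈ U g h × U g h ⊆ O

  LU : Level
  LU = c₁ ⊔ ℓ₁ ⊔ ℓ₂ ⊔ c₂ ⊔ ℓ₃ ⊔ ℓ₄ ⊔ suc ℓ

  interior : ∀ {s} → Pred Pro s → Pred Pro (suc (LU ⊔ s))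
  interior {s} I f = Σ (Pred Pro (LU ⊔ s)) λ O → IsOpen O × f ∈ O × O ⊆ I

  closure : ∀ {s} → Pred Pro s → Pred Pro (suc (LU ⊔ s))
  closure {s} I f = ∀ (O : Pred Pro (LU ⊔ s)) → IsOpen O → f ∈ O →
                      Σ Pro λ k → k ∈ O × k ∈ I

  IsDownSet : ∀ {s} → Pred Pro s → Set _
  IsDownSet I = ∀ {f g} → f ≤ᵖ g → g ∈ I → f ∈ I

  IsUpSet : ∀ {s} → Pred Pro s → Set _
  IsUpSet I = ∀ {f g} → f ≤ᵖ g → f ∈ I → g ∈ I

{-# OPTIONS --safe #-}
-- Profunctors form a lattice under pointwise ∧ and ∨, with a small least element ⊥ᵖ and a
-- large greatest element ⊤ᵖ.  For a down-set I and a ≤ h, whether the basic set U(a,h) lies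
-- inside I depends only on h (for k ≤ h, the element a ∨ k of U(a,h) lies above k), and
-- whether it meets I depends only on a (for a ≤ k ∈ I, the element h ∧ k of U(a,h) lies
-- below k).  So if g ≤ f ∈ U(a,h), then g lies in U(⊥ᵖ,h), which is inside I when U(a,h) is;
-- and if f ≤ g with f ∈ U(a,h), then g ∈ U(a,⊤ᵖ), and U(a,h) meets I when U(a,⊤ᵖ) does.
-- Up-sets are dual.
module Submission where

open import Defs
open import Level using (Level; Lift; lift; lower; _⊔_)
open import Function using (_∘_)
open import Relation.Binary.Bundles using (Poset)
open import Relation.Unary using (Pred; _∈_; _⊆_; _≬_)
open import Data.Product using (Σ; _×_; _,_; proj₁; proj₂)
open import Data.Sum using (_⊎_; inj₁; inj₂; [_,_])
open import Data.Unit.Polymorphic using (⊤)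
open import Data.Empty.Polymorphic using (⊥)
open import Data.Empty using (⊥-elim)
open import Data.List using ([])

module ProTopology {c₁ ℓ₁ ℓ₂ c₂ ℓ₃ ℓ₄ : Level} (P : Poset c₁ ℓ₁ ℓ₂) (Q : Poset c₂ ℓ₃ ℓ₄)
                   (ℓ : Level) where
  open ProDefs P Q ℓ

  infixr 27 _∧ᵖ_
  infixr 26 _∨ᵖ_

  _∧ᵖ_ : Pro → Pro → Pro
  app (f ∧ᵖ g) p = record
    { mem    = λ q → q ∈ mem (app f p) × q ∈ mem (app g p)
    ; closed = λ q'≤q (x , y) → closed (app f p) q'≤q x , closed (app g p) q'≤q y }
  mono (f ∧ᵖ g) p≤p' (x , y) = mono f p≤p' x , mono g p≤p' y

  _∨ᵖ_ : Pro → Pro → Pro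
  app (f ∨ᵖ g) p = record
    { mem    = λ q → q ∈ mem (app f p) ⊎ q ∈ mem (app g p)
    ; closed = λ q'≤q → [ inj₁ ∘ closed (app f p) q'≤q , inj₂ ∘ closed (app g p) q'≤q ] }
  mono (f ∨ᵖ g) p≤p' = [ inj₁ ∘ mono f p≤p' , inj₂ ∘ mono g p≤p' ]

  ⊤ᵖ : Pro
  app ⊤ᵖ p = record { mem = λ _ → ⊤ ; closed = λ _ x → x }
  mono ⊤ᵖ _ x = x

  ⊥ᵖ : Pro
  app ⊥ᵖ p = record { mem = λ _ → ⊥ ; closed = λ _ x → x }
  mono ⊥ᵖ _ x = x

  ≤ᵖ-trans : ∀ {f g h} → f ≤ᵖ g → g ≤ᵖ h → f ≤ᵖ h
  ≤ᵖ-trans f≤g g≤h p = g≤h p ∘ f≤g p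

  x∧y≤x : ∀ f g → f ∧ᵖ g ≤ᵖ f
  x∧y≤x f g p = proj₁

  x∧y≤y : ∀ f g → f ∧ᵖ g ≤ᵖ g
  x∧y≤y f g p = proj₂

  ∧-greatest : ∀ {f g h} → h ≤ᵖ f → h ≤ᵖ g → h ≤ᵖ f ∧ᵖ g
  ∧-greatest h≤f h≤g p x = h≤f p x , h≤g p x

  x≤x∨y : ∀ f g → f ≤ᵖ f ∨ᵖ g
  x≤x∨y f g p = inj₁

  y≤x∨y : ∀ f g → g ≤ᵖ f ∨ᵖ g
  y≤x∨y f g p = inj₂

  ∨-least : ∀ {f g h} → f ≤ᵖ h → g ≤ᵖ h → f ∨ᵖ g ≤ᵖ h
  ∨-least f≤h g≤h p = [ f≤h p , g≤h p ]

  ⊤ᵖ-maximum : ∀ {f} → f ≤ᵖ ⊤ᵖ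
  ⊤ᵖ-maximum p _ = _

  ⊥ᵖ-minimum : ∀ {f} → ⊥ᵖ ≤ᵖ f
  ⊥ᵖ-minimum p ()

  ⊤ᵖ-large : Large ⊤ᵖ
  ⊤ᵖ-large = [] , λ p ¬full → ⊥-elim (¬full λ _ → _)

  ⊥ᵖ-small : Small ⊥ᵖ
  ⊥ᵖ-small = [] , λ p q ()

  module _ {s : Level} where

    Uˡ : Pro → Pro → Pred Pro (LU ⊔ s)
    Uˡ a h f = Lift (LU ⊔ s) (f ∈ U a h)

    Uˡ-open : ∀ a h → Small a → Large h → IsOpen (Uˡ a h)
    Uˡ-open a h a-small h-large f (lift f∈U) = a , h , a-small , h-large , f∈U , lift

    module _ {I : Pred Pro s} where

      U⊆downSet-anyLower : IsDownSet I → ∀ {a h} b → a ≤ᵖ h → U a h ⊆ I → U b h ⊆ I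
      U⊆downSet-anyLower I-down {a} {h} b a≤h Uah⊆I {k} (_ , k≤h) =
        I-down {k} {a ∨ᵖ k} (y≤x∨y a k) (Uah⊆I (x≤x∨y a k , ∨-least {a} {k} {h} a≤h k≤h))

      U⊆upSet-anyUpper : IsUpSet I → ∀ {a h} b → a ≤ᵖ h → U a h ⊆ I → U a b ⊆ I
      U⊆upSet-anyUpper I-up {a} {h} b a≤h Uah⊆I {k} (a≤k , _) =
        I-up {k ∧ᵖ h} {k} (x∧y≤x k h) (Uah⊆I (∧-greatest {k} {h} {a} a≤k a≤h , x∧y≤y k h))

      U≬downSet-anyUpper : IsDownSet I → ∀ {a b h} → a ≤ᵖ h → U a b ≬ I → U a h ≬ I
      U≬downSet-anyUpper I-down {a} {h = h} a≤h (k , (a≤k , _) , k∈I) =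
        h ∧ᵖ k , (∧-greatest {h} {k} {a} a≤h a≤k , x∧y≤x h k) , I-down (x∧y≤y h k) k∈I

      U≬upSet-anyLower : IsUpSet I → ∀ {a b h} → a ≤ᵖ h → U b h ≬ I → U a h ≬ I
      U≬upSet-anyLower I-up {a} {h = h} a≤h (k , (_ , k≤h) , k∈I) =
        a ∨ᵖ k , (x≤x∨y a k , ∨-least {a} {k} {h} a≤h k≤h) , I-up (y≤x∨y a k) k∈I

      interior⇒basic⊆ : ∀ f → f ∈ interior I →
                         Σ Pro λ a → Σ Pro λ h → Small a × Large h × f ∈ U a h × U a h ⊆ I
      interior⇒basic⊆ f (O , O-open , f∈O , O⊆I) with O-open f f∈O
      ... | a , h , a-small , h-large , f∈U , U⊆O = a , h , a-small , h-large , f∈U , O⊆I ∘ U⊆O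

      basic⊆⇒interior : ∀ f a h → Small a → Large h → f ∈ U a h → U a h ⊆ I → f ∈ interior I
      basic⊆⇒interior f a h a-small h-large f∈U U⊆I =
        Uˡ a h , Uˡ-open a h a-small h-large , lift f∈U , U⊆I ∘ lower

      closure⇒basic≬ : ∀ f → f ∈ closure I →
                       ∀ a h → Small a → Large h → f ∈ U a h → U a h ≬ I
      closure⇒basic≬ f f∈Ī a h a-small h-large f∈U
        with f∈Ī (Uˡ a h) (Uˡ-open a h a-small h-large) (lift f∈U)
      ... | k , lift k∈U , k∈I = k , k∈U , k∈I

      basic≬⇒closure : ∀ {f} → (∀ a h → Small a → Large h → f ∈ U a h → U a h ≬ I) →
                       f ∈ closure I
      basic≬⇒closure {f} meets O O-open f∈O with O-open f f∈O
      ... | a , h , a-small , h-large , f∈U , U⊆O with meets a h a-small h-large f∈U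
      ... | k , k∈U , k∈I = k , U⊆O k∈U , k∈I

      interior-downSet : IsDownSet I → IsDownSet (interior I)
      interior-downSet I-down {g} {f} g≤f f∈I° with interior⇒basic⊆ f f∈I°
      ... | a , h , _ , h-large , (a≤f , f≤h) , U⊆I =
        basic⊆⇒interior g ⊥ᵖ h ⊥ᵖ-small h-large (⊥ᵖ-minimum {g} , ≤ᵖ-trans {g} {f} {h} g≤f f≤h)
          (U⊆downSet-anyLower I-down {a} {h} ⊥ᵖ (≤ᵖ-trans {a} {f} {h} a≤f f≤h) U⊆I)

      closure-downSet : IsDownSet I → IsDownSet (closure I)
      closure-downSet I-down {f} {g} f≤g g∈Ī = basic≬⇒closure λ a h a-small h-large (a≤f , f≤h) →
        U≬downSet-anyUpper I-down {a} {⊤ᵖ} {h} (≤ᵖ-trans {a} {f} {h} a≤f f≤h)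
          (closure⇒basic≬ g g∈Ī a ⊤ᵖ a-small ⊤ᵖ-large (≤ᵖ-trans {a} {f} {g} a≤f f≤g , ⊤ᵖ-maximum {g}))

      interior-upSet : IsUpSet I → IsUpSet (interior I)
      interior-upSet I-up {f} {g} f≤g f∈I° with interior⇒basic⊆ f f∈I°
      ... | a , h , a-small , _ , (a≤f , f≤h) , U⊆I =
        basic⊆⇒interior g a ⊤ᵖ a-small ⊤ᵖ-large (≤ᵖ-trans {a} {f} {g} a≤f f≤g , ⊤ᵖ-maximum {g})
          (U⊆upSet-anyUpper I-up {a} {h} ⊤ᵖ (≤ᵖ-trans {a} {f} {h} a≤f f≤h) U⊆I)

      closure-upSet : IsUpSet I → IsUpSet (closure I)
      closure-upSet I-up {f} {g} f≤g f∈Ī = basic≬⇒closure λ a h a-small h-large (a≤g , g≤h) →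
        U≬upSet-anyLower I-up {a} {⊥ᵖ} {h} (≤ᵖ-trans {a} {g} {h} a≤g g≤h)
          (closure⇒basic≬ f f∈Ī ⊥ᵖ h ⊥ᵖ-small h-large (⊥ᵖ-minimum {f} , ≤ᵖ-trans {f} {g} {h} f≤g g≤h))

lemma5p6 : ∀ {c₁ ℓ₁ ℓ₂ c₂ ℓ₃ ℓ₄ : Level} (P : Poset c₁ ℓ₁ ℓ₂) (Q : Poset c₂ ℓ₃ ℓ₄)
             (ℓ s : Level) → let open ProDefs P Q ℓ in
             (∀ (I : Pred Pro s) → IsDownSet I →
                IsDownSet (closure I) × IsDownSet (interior I))
             × (∀ (I : Pred Pro s) → IsUpSet I →
                IsUpSet (closure I) × IsUpSet (interior I))
lemma5p6 P Q ℓ s =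
    (λ I I-down → closure-downSet I-down , interior-downSet I-down)
  , (λ I I-up → closure-upSet I-up , interior-upSet I-up)
  where open ProTopology P Q ℓ
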